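{- Let $A$ be a totally ordered alphabet and let $\ell_1,\dots,\ell_n$ ($n\ge1$) be Lyndon words over $A$ such that $\ell_{i+1}$ is a prefix of $\ell_i$ for each $i=1,\dots,n-1$, and such that $\ell_n$ has length at least $2$. Let $\ell_n=\ell_n'\ell_n''$ be the left standard factorization of $\ell_n$. Then (i) $(\ell_1\cdots\ell_{n-1}\ell_n')^\omega<(\ell_1\cdots\ell_n)^\omega$; (ii) if moreover $n\ge2$, then $(\ell_1\cdots\ell_n)^\omega\le(\ell_1\cdots\ell_{n-1})^\omega$.
   Context: The order $<$ on finite and infinite words is the lexicographical order induced by the order of $A$. For a nonempty finite word $x$, $x^\omega=xxx\cdots$. A nonempty word $w$ is a Lyndon word if for every factorization $w=uv$ with $u,v$ nonempty one has $w<v$. The left standard factorization of a Lyndon word $w$ of length at least $2$ is $w=uv$ where $u$ is the longest nonempty proper prefix of $w$ that is a Lyndon word. -}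

module Defs where

open import Level using (Level; _⊔_)
open import Data.Nat using (ℕ; zero; suc; _≤_) renaming (_<_ to _<ℕ_)
open import Data.Fin using (Fin)
open import Data.List using (List; []; _∷_; _++_; length; concat; tabulate)
open import Data.Maybe using (Maybe; just; nothing)
open import Data.Product using (Σ; ∃; _×_; _,_)
open import Data.Sum using (_⊎_)
open import Relation.Binary using (Rel)
open import Relation.Binary.PropositionalEquality using (_≡_; _≢_)

private variable
  a r : Level
  A : Set a

Prefix : List A → List A → Set _
Prefix u w = ∃ λ v → u ++ v ≡ w

LexLt : (_<_ : Rel A r) → List A → List A → Set _
LexLt {A = A} _<_ u v =
  (∃ λ w → w ≢ [] × u ++ w ≡ v)
  ⊎ (Σ (List A) λ p → Σ A λ x → Σ A λ y → Σ (List A) λ s → Σ (List A) λ t →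
       x < y × u ≡ p ++ x ∷ s × v ≡ p ++ y ∷ t)

Lyndon : (_<_ : Rel A r) → List A → Set _
Lyndon _<_ w = w ≢ [] × (∀ u v → u ≢ [] → v ≢ [] → w ≡ u ++ v → LexLt _<_ w v)

LeftStdFact : (_<_ : Rel A r) → List A → List A → List A → Set _
LeftStdFact _<_ w u v =
  w ≡ u ++ v × u ≢ [] × v ≢ [] × Lyndon _<_ u
  × (∀ p q → p ≢ [] → q ≢ [] → w ≡ p ++ q → Lyndon _<_ p → length p ≤ length u)

prod : ∀ {k} → (Fin k → List A) → List A
prod f = concat (tabulate f)

pow : List A → ℕ → List A
pow x zero = []
pow x (suc k) = x ++ pow x k

nth : List A → ℕ → Maybe A
nth [] _ = nothing
nth (x ∷ xs) zero = just x
nth (x ∷ xs) (suc i) = nth xs i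

-- The infinite word x^ω = x x x ⋯ as a function of positions; the i-th letter
-- of x^ω is the i-th letter of x^(i+1).  For nonempty x every position is
-- defined (just _); for x = [] everything is nothing.
ω : List A → ℕ → Maybe A
ω x i = nth (pow x (suc i)) i

InfLt : (_<_ : Rel A r) → (ℕ → Maybe A) → (ℕ → Maybe A) → Set _
InfLt {A = A} _<_ s t = Σ ℕ λ k → (∀ i → i <ℕ k → s i ≡ t i)
  × Σ A λ x → Σ A λ y → s k ≡ just x × t k ≡ just y × x < y

InfLe : (_<_ : Rel A r) → (ℕ → Maybe A) → (ℕ → Maybe A) → Set _
InfLe _<_ s t = InfLt _<_ s t ⊎ (∀ i → s i ≡ t i)

-- Write y ◂ z for the infinite word z prefixed by the finite word y. If y is
-- nonempty and y z ≤ z, then y^ω ≤ z: iterating, yⁿ z keeps its first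
-- difference with z at the same position k, while yⁿ z agrees with y^ω on
-- the first n letters; so for n > k, y^ω differs from z first at k as well.
--
-- (i) Put b = ℓ₁⋯ℓₙ = c ℓₙ'' with c = ℓ₁⋯ℓₙ₋₁ℓₙ'. As ℓₙ is Lyndon it is
-- smaller than its proper suffix ℓₙ'' at a letter, and ℓₙ is a prefix of b,
-- so b^ω < ℓₙ'' b^ω; prefixing c gives c b^ω < b^ω, whence c^ω < b^ω.
--
-- (ii) Each ℓᵢ is Lyndon with prefix ℓₙ, so ℓₙ ℓᵢ z ≤ ℓᵢ ℓₙ z, and therefore
-- ℓₙ P z ≤ P ℓₙ z for P = ℓ₁⋯ℓₙ₋₁. For D = ℓₙ P^ω this reads D ≤ P D, so
-- D ≤ P^ω; then P ℓₙ P^ω ≤ P^ω, whence (P ℓₙ)^ω ≤ P^ω.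
module Submission where

open import Defs
open import Level using (Level; _⊔_)
open import Data.Nat using (ℕ; zero; suc; _≤_; _+_; _∸_; z≤n; s≤s) renaming (_<_ to _<ℕ_)
open import Data.Nat.Properties
  using ( ≤-trans; <⇒≤; <-≤-trans; <-trans; <-irrefl; <-cmp; n<1+n; m<n⇒m<1+n
        ; m≤n+m; m≤m+n; m<n+m; m+[n∸m]≡n)
open import Data.Fin using (Fin; zero; suc; inject₁; fromℕ)
open import Data.List using (List; []; _∷_; _++_; length; concat)
open import Data.List.Properties using (++-assoc; ++-identityʳ; length-++; length-++-≤ˡ; length-++-≤ʳ)
open import Data.List.Relation.Unary.All using (All; []; _∷_)
open import Data.List.Relation.Unary.All.Properties using (tabulate⁺)
open import Data.Maybe using (Maybe; just; nothing)
open import Data.Maybe.Properties using (just-injective)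
open import Data.Product using (Σ; _×_; _,_; proj₁)
open import Data.Sum using (inj₁; inj₂)
open import Data.Empty using (⊥-elim)
open import Function using (_∘_; flip)
open import Relation.Binary using (Rel; IsStrictTotalOrder; Transitive; tri<; tri≈; tri>)
open import Relation.Binary.PropositionalEquality
  using (_≡_; _≢_; _≗_; refl; sym; trans; cong; subst; module ≡-Reasoning)

module _ {a : Level} {A : Set a} where

  private variable
    r : Level
    R : Rel A r
    k m n : ℕ
    c p q w x y : List A
    s s′ t t′ u z : ℕ → Maybe A

  ≢[]⇒0<length : x ≢ [] → 0 <ℕ length x
  ≢[]⇒0<length {[]} x≢[] = ⊥-elim (x≢[] refl)
  ≢[]⇒0<length {_ ∷ _} _ = s≤s z≤n

  ++-≢[]ˡ : x ≢ [] → x ++ y ≢ []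
  ++-≢[]ˡ {[]} x≢[] = ⊥-elim (x≢[] refl)
  ++-≢[]ˡ {_ ∷ _} _ ()

  ++-≢[]ʳ : (x : List A) → y ≢ [] → x ++ y ≢ []
  ++-≢[]ʳ [] y≢[] = y≢[]
  ++-≢[]ʳ (_ ∷ _) _ ()

  infixr 5 _◂_
  _◂_ : List A → (ℕ → Maybe A) → (ℕ → Maybe A)
  ([] ◂ s) i = s i
  ((c ∷ w) ◂ s) zero = just c
  ((c ∷ w) ◂ s) (suc i) = (w ◂ s) i

  ◂-++ : (x y : List A) (s : ℕ → Maybe A) → (x ++ y) ◂ s ≗ x ◂ y ◂ s
  ◂-++ [] y s i = refl
  ◂-++ (c ∷ x) y s zero = refl
  ◂-++ (c ∷ x) y s (suc i) = ◂-++ x y s i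

  ◂-congˡ : (s : ℕ → Maybe A) → x ≡ y → x ◂ s ≗ y ◂ s
  ◂-congˡ s refl i = refl

  ◂-congʳ : (w : List A) → s ≗ t → w ◂ s ≗ w ◂ t
  ◂-congʳ [] s≗t i = s≗t i
  ◂-congʳ (c ∷ w) s≗t zero = refl
  ◂-congʳ (c ∷ w) s≗t (suc i) = ◂-congʳ w s≗t i

  ◂-length+ : (w : List A) (s : ℕ → Maybe A) (i : ℕ) → (w ◂ s) (length w + i) ≡ s i
  ◂-length+ [] s i = refl
  ◂-length+ (c ∷ w) s i = ◂-length+ w s i

  nth≗◂ : (w : List A) → nth w ≗ w ◂ (λ _ → nothing)
  nth≗◂ [] i = refl
  nth≗◂ (c ∷ w) zero = refl
  nth≗◂ (c ∷ w) (suc i) = nth≗◂ w i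

  Agree : ℕ → (ℕ → Maybe A) → (ℕ → Maybe A) → Set a
  Agree k s t = ∀ i → i <ℕ k → s i ≡ t i

  Agree-sym : Agree k s t → Agree k t s
  Agree-sym st i i<k = sym (st i i<k)

  Agree-trans : Agree k s t → Agree k t u → Agree k s u
  Agree-trans st tu i i<k = trans (st i i<k) (tu i i<k)

  Agree-≤ : m ≤ n → Agree n s t → Agree m s t
  Agree-≤ m≤n st i i<m = st i (<-≤-trans i<m m≤n)

  ◂-Agree : (w : List A) → Agree k s t → Agree (length w + k) (w ◂ s) (w ◂ t)
  ◂-Agree [] st = st
  ◂-Agree (c ∷ w) st zero _ = refl
  ◂-Agree (c ∷ w) st (suc i) (s≤s i<k) = ◂-Agree w st i i<k

  pow-+ : (x : List A) (m n : ℕ) → pow x (m + n) ≡ pow x m ++ pow x n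
  pow-+ x zero n = refl
  pow-+ x (suc m) n = trans (cong (x ++_) (pow-+ x m n)) (sym (++-assoc x (pow x m) (pow x n)))

  n≤length-pow : x ≢ [] → n ≤ length (pow x n)
  n≤length-pow {[]} x≢[] = ⊥-elim (x≢[] refl)
  n≤length-pow {c ∷ x} {zero} _ = z≤n
  n≤length-pow {c ∷ x} {suc n} x≢[] =
    s≤s (≤-trans (n≤length-pow x≢[]) (length-++-≤ʳ (pow (c ∷ x) n) {x}))

  pow◂-Agree : x ≢ [] → m ≤ n → Agree m (pow x m ◂ s) (pow x n ◂ t)
  pow◂-Agree {x} {m} {n} {s} {t} x≢[] m≤n i i<m = begin
    (pow x m ◂ s) i                     ≡⟨ ◂-Agree (pow x m) (λ _ ()) i i<length+0 ⟩
    (pow x m ◂ pow x (n ∸ m) ◂ t) i     ≡⟨ ◂-++ (pow x m) (pow x (n ∸ m)) t i ⟨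
    ((pow x m ++ pow x (n ∸ m)) ◂ t) i  ≡⟨ ◂-congˡ t split i ⟩
    (pow x n ◂ t) i                     ∎
    where
    open ≡-Reasoning
    split : pow x m ++ pow x (n ∸ m) ≡ pow x n
    split = trans (sym (pow-+ x m (n ∸ m))) (cong (pow x) (m+[n∸m]≡n m≤n))
    i<length+0 : i <ℕ length (pow x m) + 0
    i<length+0 = <-≤-trans i<m (≤-trans (n≤length-pow x≢[]) (m≤m+n _ 0))

  ω-Agree-pow◂ : x ≢ [] → Agree n (ω x) (pow x n ◂ s)
  ω-Agree-pow◂ {x} x≢[] i i<n = trans (nth≗◂ (pow x (suc i)) i) (pow◂-Agree x≢[] i<n i (n<1+n i))

  ω-unfold : x ≢ [] → ω x ≗ x ◂ ω x
  ω-unfold {x} x≢[] i = begin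
    ω x i                     ≡⟨ ω-Agree-pow◂ x≢[] i (n<1+n i) ⟩
    (pow x (suc i) ◂ ω x) i   ≡⟨ ◂-++ x (pow x i) (ω x) i ⟩
    (x ◂ pow x i ◂ ω x) i     ≡⟨ ◂-Agree x (Agree-sym (ω-Agree-pow◂ x≢[])) i
                                   (m<n+m i (≢[]⇒0<length x≢[])) ⟩
    (x ◂ ω x) i               ∎
    where open ≡-Reasoning

  LtAt : Rel A r → ℕ → (ℕ → Maybe A) → (ℕ → Maybe A) → Set (a ⊔ r)
  LtAt R k s t = Agree k s t × Σ A λ α → Σ A λ β → s k ≡ just α × t k ≡ just β × R α β

  LtAt-respˡ : Agree (suc k) s s′ → LtAt R k s t → LtAt R k s′ t
  LtAt-respˡ {k} ss′ (st , α , β , sk , tk , αβ) =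
    (λ i i<k → trans (sym (ss′ i (m<n⇒m<1+n i<k))) (st i i<k)) , α , β ,
    trans (sym (ss′ k (n<1+n k))) sk , tk , αβ

  InfLt-resp : s ≗ s′ → t ≗ t′ → InfLt R s t → InfLt R s′ t′
  InfLt-resp s≗s′ t≗t′ (k , st , α , β , sk , tk , αβ) =
    k , (λ i i<k → trans (sym (s≗s′ i)) (trans (st i i<k) (t≗t′ i))) , α , β ,
    trans (sym (s≗s′ k)) sk , trans (sym (t≗t′ k)) tk , αβ

  InfLt-◂ : (w : List A) → InfLt R s t → InfLt R (w ◂ s) (w ◂ t)
  InfLt-◂ {s = s} {t} w (k , st , α , β , sk , tk , αβ) =
    length w + k , ◂-Agree w st , α , β , trans (◂-length+ w s k) sk , trans (◂-length+ w t k) tk , αβ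

  InfLt-trans : Transitive R → InfLt R s t → InfLt R t u → InfLt R s u
  InfLt-trans {R = R} R-trans (k , st , α , β , sk , tk , αβ)
                              (k′ , tu , α′ , β′ , tk′ , uk′ , α′β′)
    with <-cmp k k′
  ... | tri< k<k′ _ _ = k , (λ i i<k → trans (st i i<k) (tu i (<-trans i<k k<k′))) , α , β ,
                        sk , trans (sym (tu k k<k′)) tk , αβ
  ... | tri≈ _ refl _ = k , Agree-trans st tu , α , β′ , sk , uk′ ,
                        R-trans (subst (R α) (just-injective (trans (sym tk) tk′)) αβ) α′β′
  ... | tri> _ _ k′<k = k′ , Agree-trans (Agree-≤ (<⇒≤ k′<k) st) tu , α′ , β′ ,
                        trans (st k′ k′<k) tk′ , uk′ , α′β′

  InfLt-flip : InfLt R s t → InfLt (flip R) t s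
  InfLt-flip (k , st , α , β , sk , tk , αβ) = k , Agree-sym st , β , α , tk , sk , αβ

  InfLe-resp : s ≗ s′ → t ≗ t′ → InfLe R s t → InfLe R s′ t′
  InfLe-resp s≗s′ t≗t′ (inj₁ s<t) = inj₁ (InfLt-resp s≗s′ t≗t′ s<t)
  InfLe-resp s≗s′ t≗t′ (inj₂ s≗t) = inj₂ (λ i → trans (sym (s≗s′ i)) (trans (s≗t i) (t≗t′ i)))

  InfLe-◂ : (w : List A) → InfLe R s t → InfLe R (w ◂ s) (w ◂ t)
  InfLe-◂ w (inj₁ s<t) = inj₁ (InfLt-◂ w s<t)
  InfLe-◂ w (inj₂ s≗t) = inj₂ (◂-congʳ w s≗t)

  InfLe-trans : Transitive R → InfLe R s t → InfLe R t u → InfLe R s u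
  InfLe-trans R-trans (inj₁ s<t) (inj₁ t<u) = inj₁ (InfLt-trans R-trans s<t t<u)
  InfLe-trans _ (inj₁ s<t) (inj₂ t≗u) = inj₁ (InfLt-resp (λ _ → refl) t≗u s<t)
  InfLe-trans _ (inj₂ s≗t) (inj₁ t<u) = inj₁ (InfLt-resp (λ i → sym (s≗t i)) (λ _ → refl) t<u)
  InfLe-trans _ (inj₂ s≗t) (inj₂ t≗u) = inj₂ (λ i → trans (s≗t i) (t≗u i))

  LetterLt : Rel A r → List A → List A → Set (a ⊔ r)
  LetterLt R x y = Σ (List A) λ p → Σ A λ α → Σ A λ β → Σ (List A) λ x′ → Σ (List A) λ y′ →
    R α β × x ≡ p ++ α ∷ x′ × y ≡ p ++ β ∷ y′

  LetterLt⇒InfLt : LetterLt R x y → InfLt R (x ◂ s) (y ◂ t)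
  LetterLt⇒InfLt {s = s} {t} (p , α , β , x′ , y′ , αβ , refl , refl) =
    InfLt-resp (λ i → sym (◂-++ p (α ∷ x′) s i)) (λ i → sym (◂-++ p (β ∷ y′) t i))
      (InfLt-◂ p (0 , (λ _ ()) , α , β , refl , refl , αβ))

  pow◂-Agree-fix : (x : List A) (n : ℕ) → Agree k (x ◂ z) z → Agree k (pow x n ◂ z) z
  pow◂-Agree-fix x zero _ _ _ = refl
  pow◂-Agree-fix {k} {z} x (suc n) xz i i<k = begin
    (pow x (suc n) ◂ z) i   ≡⟨ ◂-++ x (pow x n) z i ⟩
    (x ◂ pow x n ◂ z) i     ≡⟨ ◂-Agree x (pow◂-Agree-fix x n xz) i
                                 (<-≤-trans i<k (m≤n+m k (length x))) ⟩
    (x ◂ z) i               ≡⟨ xz i i<k ⟩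
    z i                     ∎
    where open ≡-Reasoning

  ω-fixpoint : x ≢ [] → x ◂ z ≗ z → ω x ≗ z
  ω-fixpoint {x} x≢[] x◂z≗z i =
    trans (ω-Agree-pow◂ x≢[] i (n<1+n i)) (pow◂-Agree-fix x (suc i) (λ j _ → x◂z≗z j) i (n<1+n i))

  ω-<-of-◂< : x ≢ [] → InfLt R (x ◂ z) z → InfLt R (ω x) z
  ω-<-of-◂< {x} {z = z} x≢[] (k , x◂z<z@(xz , _)) = k , LtAt-respˡ x◂z≈ω x◂z<z
    where
    x◂z≈pow◂z : Agree (suc k) (x ◂ z) (pow x (suc k) ◂ z)
    x◂z≈pow◂z i i<1+k = trans
      (◂-Agree x (Agree-sym (pow◂-Agree-fix x k xz)) i (<-≤-trans i<1+k (m<n+m k (≢[]⇒0<length x≢[]))))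
      (sym (◂-++ x (pow x k) z i))
    x◂z≈ω : Agree (suc k) (x ◂ z) (ω x)
    x◂z≈ω = Agree-trans x◂z≈pow◂z (Agree-sym (ω-Agree-pow◂ x≢[]))

  ω-≤-of-◂≤ : x ≢ [] → InfLe R (x ◂ z) z → InfLe R (ω x) z
  ω-≤-of-◂≤ x≢[] (inj₁ x◂z<z) = inj₁ (ω-<-of-◂< x≢[] x◂z<z)
  ω-≤-of-◂≤ x≢[] (inj₂ x◂z≗z) = inj₂ (ω-fixpoint x≢[] x◂z≗z)

  ω-≥-of-≤◂ : x ≢ [] → InfLe R z (x ◂ z) → InfLe R z (ω x)
  ω-≥-of-≤◂ x≢[] (inj₁ z<x◂z) = inj₁ (InfLt-flip (ω-<-of-◂< x≢[] (InfLt-flip z<x◂z)))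
  ω-≥-of-≤◂ x≢[] (inj₂ z≗x◂z) = inj₂ (λ i → sym (ω-fixpoint x≢[] (λ j → sym (z≗x◂z j)) i))

  Lyndon⇒LetterLt-suffix : Lyndon R w → w ≡ p ++ q → p ≢ [] → q ≢ [] → LetterLt R w q
  Lyndon⇒LetterLt-suffix {w = w} {p} {q} (_ , w<suffix) w≡pq p≢[] q≢[]
    with w<suffix p q p≢[] q≢[] w≡pq
  ... | inj₂ w<q = w<q
  ... | inj₁ (_ , _ , wy≡q) = ⊥-elim (<-irrefl refl (<-≤-trans q<w w≤q))
    where
    q<w : length q <ℕ length w
    q<w = subst (length q <ℕ_) (sym (trans (cong length w≡pq) (length-++ p)))
                (m<n+m (length q) (≢[]⇒0<length p≢[]))
    w≤q : length w ≤ length q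
    w≤q = subst (length w ≤_) (cong length wy≡q) (length-++-≤ˡ w)

  Lyndon-prefix-◂-≤ : x ≢ [] → Lyndon R w → Prefix x w → (z : ℕ → Maybe A) →
                      InfLe R (x ◂ w ◂ z) (w ◂ x ◂ z)
  Lyndon-prefix-◂-≤ {x} x≢[] _ ([] , refl) z =
    inj₂ (λ i → trans (◂-congʳ x (◂-congˡ z (++-identityʳ x)) i)
                      (◂-congˡ (x ◂ z) (sym (++-identityʳ x)) i))
  Lyndon-prefix-◂-≤ {x} x≢[] w-lyndon (q@(_ ∷ _) , refl) z =
    inj₁ (InfLt-resp (λ _ → refl) (λ i → sym (◂-++ x q (x ◂ z) i))
           (InfLt-◂ x (LetterLt⇒InfLt (Lyndon⇒LetterLt-suffix w-lyndon refl x≢[] λ ()))))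

  concat-prefix-◂-≤ : Transitive R → x ≢ [] → {ws : List (List A)} →
                      All (λ w → Lyndon R w × Prefix x w) ws → (z : ℕ → Maybe A) →
                      InfLe R (x ◂ concat ws ◂ z) (concat ws ◂ x ◂ z)
  concat-prefix-◂-≤ R-trans x≢[] [] z = inj₂ (λ _ → refl)
  concat-prefix-◂-≤ {x = x} R-trans x≢[] {w ∷ ws} ((w-lyndon , x⊑w) ∷ rest) z =
    InfLe-trans R-trans
      (InfLe-resp (λ i → sym (◂-congʳ x (◂-++ w (concat ws) z) i)) (λ _ → refl)
        (Lyndon-prefix-◂-≤ x≢[] w-lyndon x⊑w (concat ws ◂ z)))
      (InfLe-resp (λ _ → refl) (λ i → sym (◂-++ w (concat ws) (x ◂ z) i))
        (InfLe-◂ w (concat-prefix-◂-≤ R-trans x≢[] rest z)))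

  ω-<-of-LetterLt-suffix : c ≢ [] → c ++ y ≡ w → Prefix x w → LetterLt R x y → InfLt R (ω c) (ω w)
  ω-<-of-LetterLt-suffix {c} {y} {w} {x} {R = R} c≢[] cy≡w (t , xt≡w) x<y =
    ω-<-of-◂< c≢[] (InfLt-resp (λ _ → refl) c◂y◂ωw≗ωw (InfLt-◂ c ωw<y◂ωw))
    where
    w≢[] : w ≢ []
    w≢[] = subst (_≢ []) cy≡w (++-≢[]ˡ c≢[])
    ωw≗x◂t◂ωw : ω w ≗ x ◂ t ◂ ω w
    ωw≗x◂t◂ωw i = trans (ω-unfold w≢[] i) (trans (◂-congˡ (ω w) (sym xt≡w) i) (◂-++ x t (ω w) i))
    ωw<y◂ωw : InfLt R (ω w) (y ◂ ω w)
    ωw<y◂ωw = InfLt-resp (λ i → sym (ωw≗x◂t◂ωw i)) (λ _ → refl) (LetterLt⇒InfLt x<y)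
    c◂y◂ωw≗ωw : c ◂ y ◂ ω w ≗ ω w
    c◂y◂ωw≗ωw i =
      trans (sym (◂-++ c y (ω w) i)) (trans (◂-congˡ (ω w) cy≡w i) (sym (ω-unfold w≢[] i)))

  ω-≤-of-◂-swap : c ≢ [] → c ++ x ≡ w → InfLe R (x ◂ c ◂ ω c) (c ◂ x ◂ ω c) →
                  InfLe R (ω w) (ω c)
  ω-≤-of-◂-swap {c} {x} {w} {R = R} c≢[] cx≡w swap =
    subst (λ v → InfLe R (ω v) (ω c)) cx≡w (ω-≤-of-◂≤ (++-≢[]ˡ c≢[]) c◂x◂ωc≤ωc)
    where
    x◂ωc≤c◂x◂ωc : InfLe R (x ◂ ω c) (c ◂ x ◂ ω c)
    x◂ωc≤c◂x◂ωc = InfLe-resp (◂-congʳ x (λ i → sym (ω-unfold c≢[] i))) (λ _ → refl) swap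
    c◂x◂ωc≤ωc : InfLe R ((c ++ x) ◂ ω c) (ω c)
    c◂x◂ωc≤ωc = InfLe-resp (λ i → sym (◂-++ c x (ω c) i)) (λ i → sym (ω-unfold c≢[] i))
                  (InfLe-◂ c (ω-≥-of-≤◂ c≢[] x◂ωc≤c◂x◂ωc))

  Prefix-trans : Prefix x y → Prefix y w → Prefix x w
  Prefix-trans {x} (p , xp≡y) (q , yq≡w) =
    p ++ q , trans (sym (++-assoc x p q)) (trans (cong (_++ q) xp≡y) yq≡w)

  last-Prefix : (ℓ : Fin (suc m) → List A) → (∀ (i : Fin m) → Prefix (ℓ (suc i)) (ℓ (inject₁ i))) →
                ∀ i → Prefix (ℓ (fromℕ m)) (ℓ i)
  last-Prefix {zero} ℓ _ zero = [] , ++-identityʳ (ℓ zero)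
  last-Prefix {suc m} ℓ chain zero = Prefix-trans (last-Prefix (ℓ ∘ suc) (chain ∘ suc) zero) (chain zero)
  last-Prefix {suc m} ℓ chain (suc i) = last-Prefix (ℓ ∘ suc) (chain ∘ suc) i

  prod-init-last : (ℓ : Fin (suc m) → List A) → prod ℓ ≡ prod (ℓ ∘ inject₁) ++ ℓ (fromℕ m)
  prod-init-last {zero} ℓ = ++-identityʳ (ℓ zero)
  prod-init-last {suc m} ℓ =
    trans (cong (ℓ zero ++_) (prod-init-last (ℓ ∘ suc))) (sym (++-assoc (ℓ zero) _ _))

  prod-≢[] : (f : Fin k → List A) → (∀ i → f i ≢ []) → 1 ≤ k → prod f ≢ []
  prod-≢[] {suc k} f f≢[] _ = ++-≢[]ˡ (f≢[] zero)

lemma6 : ∀ {a r : Level} (A : Set a) (_<_ : Rel A r) → IsStrictTotalOrder _≡_ _<_ →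
    (m : ℕ) (ℓ : Fin (suc m) → List A) →
    (∀ i → Lyndon _<_ (ℓ i)) →
    (∀ (i : Fin m) → Prefix (ℓ (suc i)) (ℓ (inject₁ i))) →
    2 ≤ length (ℓ (fromℕ m)) →
    (u v : List A) → LeftStdFact _<_ (ℓ (fromℕ m)) u v →
    InfLt _<_ (ω (prod (ℓ ∘ inject₁) ++ u)) (ω (prod ℓ))
    × (1 ≤ m → InfLe _<_ (ω (prod ℓ)) (ω (prod (ℓ ∘ inject₁))))
lemma6 A _<_ sto m ℓ lyndon chain _ u v (ℓₘ≡uv , u≢[] , v≢[] , _) =
    ω-<-of-LetterLt-suffix (++-≢[]ʳ P u≢[]) Pu++v≡prod ℓₘ⊑prod
      (Lyndon⇒LetterLt-suffix (lyndon (fromℕ m)) ℓₘ≡uv u≢[] v≢[])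
  , λ 1≤m → ω-≤-of-◂-swap (prod-≢[] (ℓ ∘ inject₁) (proj₁ ∘ lyndon ∘ inject₁) 1≤m)
                           (sym (prod-init-last ℓ))
      (concat-prefix-◂-≤ (IsStrictTotalOrder.trans sto) (proj₁ (lyndon (fromℕ m)))
        (tabulate⁺ (λ i → lyndon (inject₁ i) , ℓₘ⊑ (inject₁ i))) (ω P))
  where
  P : List A
  P = prod (ℓ ∘ inject₁)
  ℓₘ⊑ : ∀ i → Prefix (ℓ (fromℕ m)) (ℓ i)
  ℓₘ⊑ = last-Prefix ℓ chain
  ℓₘ⊑prod : Prefix (ℓ (fromℕ m)) (prod ℓ)
  ℓₘ⊑prod = Prefix-trans (ℓₘ⊑ zero) (prod (ℓ ∘ suc) , refl)
  Pu++v≡prod : (P ++ u) ++ v ≡ prod ℓ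
  Pu++v≡prod = trans (++-assoc P u v) (trans (cong (P ++_) (sym ℓₘ≡uv)) (sym (prod-init-last ℓ)))
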